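{- (a) For $n\ge 4$, $\chi'_L(W_n)=n$. (b) For $n\ge 4$, $\chi'_L(F_n)=n$; moreover $\chi'_L(F_2)=3$ and $\chi'_L(F_3)=4$. (c) For $n\ge 3$, $\chi'_L(Wm(n))=2n$, and $\chi'_L(Wm(2))=5$. (d) For $n\ge 3$, $\chi'_L(B_n)=2n+2$, and $\chi'_L(B_2)=6$.
   Context: For graphs $G,H$, the join $G+H$ is obtained from disjoint copies of $G$ and $H$ by joining every vertex of $G$ to every vertex of $H$. $C_n$ and $P_n$ denote the cycle and path on $n$ vertices, and $nK_2$ the disjoint union of $n$ edges. The wheel is $W_n=K_1+C_n$, the fan is $F_n=K_1+P_n$, the windmill is $Wm(n)=K_1+nK_2$ (a center adjacent to $2n$ vertices $v_1,\dots,v_{2n}$, with edges $v_{2i-1}v_{2i}$), and the book is $B_n=K_2+nK_2$. For a proper edge coloring $c:E(G)\to\{1,\dots,k\}$ of a connected graph $G$, let $\pi=(\mathcal{C}_1,\dots,\mathcal{C}_k)$ be the ordered partition of $E(G)$ into color classes. For a vertex $v$ and an edge $e=xy$, $d(v,e)=\min\{d(v,x),d(v,y)\}$, and $d(v,\mathcal{C}_i)=\min\{d(v,e): e\in\mathcal{C}_i\}$. The edge color code of $v$ is $c_\pi(v)=(d(v,\mathcal{C}_1),\dots,d(v,\mathcal{C}_k))$. The coloring is an edge-locating coloring if distinct vertices have distinct edge color codes; $\chi'_L(G)$ is the minimum number of colors in an edge-locating coloring of $G$. -}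

module Defs where

open import Data.Nat using (ℕ; zero; suc; _+_; _*_; _≤_; _≡ᵇ_; _/_)
open import Data.Bool using (Bool; true; false; _∧_; _∨_; not)
open import Data.Fin using (Fin; toℕ; splitAt)
open import Data.Sum using (_⊎_; inj₁; inj₂)
open import Data.Product using (Σ; ∃; _×_; _,_)
open import Relation.Binary.PropositionalEquality using (_≡_; _≢_)

-- Finite simple graphs: vertex set Fin V, adjacency given by a Bool
-- function (all concrete graphs below are symmetric and loopless).

record Graph : Set where
  field
    V   : ℕ
    adj : Fin V → Fin V → Bool
open Graph public

Adj : (G : Graph) → Fin (V G) → Fin (V G) → Set
Adj G x y = adj G x y ≡ true

K1 : Graph
K1 = record { V = 1 ; adj = λ _ _ → false }

K2 : Graph
K2 = record { V = 2 ; adj = λ i j → not (toℕ i ≡ᵇ toℕ j) }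

pathAdj : (n : ℕ) → Fin n → Fin n → Bool
pathAdj n i j = (toℕ j ≡ᵇ suc (toℕ i)) ∨ (toℕ i ≡ᵇ suc (toℕ j))

P : ℕ → Graph
P n = record { V = n ; adj = pathAdj n }

-- cycle C_n (intended for n ≥ 3): the path plus the edge {0, n-1}
C : ℕ → Graph
C n = record { V = n ; adj = λ i j →
  pathAdj n i j
  ∨ ((toℕ i ≡ᵇ 0) ∧ (suc (toℕ j) ≡ᵇ n))
  ∨ ((toℕ j ≡ᵇ 0) ∧ (suc (toℕ i) ≡ᵇ n)) }

-- n K₂ on vertices 0,…,2n-1 with edges {2i, 2i+1}
nK2 : ℕ → Graph
nK2 n = record { V = n * 2 ; adj = λ i j →
  ((toℕ i / 2) ≡ᵇ (toℕ j / 2)) ∧ not (toℕ i ≡ᵇ toℕ j) }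

joinAdj : (G H : Graph) → Fin (V G + V H) → Fin (V G + V H) → Bool
joinAdj G H x y with splitAt (V G) x | splitAt (V G) y
... | inj₁ a | inj₁ b = adj G a b
... | inj₂ a | inj₂ b = adj H a b
... | inj₁ _ | inj₂ _ = true
... | inj₂ _ | inj₁ _ = true

_⊕_ : Graph → Graph → Graph
G ⊕ H = record { V = V G + V H ; adj = joinAdj G H }

Wheel : ℕ → Graph
Wheel n = K1 ⊕ C n

Fan : ℕ → Graph
Fan n = K1 ⊕ P n

Windmill : ℕ → Graph
Windmill n = K1 ⊕ nK2 n

Book : ℕ → Graph
Book n = K2 ⊕ nK2 n

data Walk (G : Graph) : Fin (V G) → Fin (V G) → ℕ → Set where
  here : ∀ {x} → Walk G x x 0
  step : ∀ {x y z m} → Adj G x y → Walk G y z m → Walk G x z (suc m)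

IsMin : (ℕ → Set) → ℕ → Set
IsMin P d = P d × (∀ m → P m → d ≤ m)

Dist : (G : Graph) → Fin (V G) → Fin (V G) → ℕ → Set
Dist G u v d = IsMin (Walk G u v) d

-- Edge colorings: c x y is the color of the edge xy (only its values on
-- edges matter; it must be symmetric on edges).
Coloring : Graph → ℕ → Set
Coloring G k = Fin (V G) → Fin (V G) → Fin k

EdgeDist : (G : Graph) → Fin (V G) → Fin (V G) → Fin (V G) → ℕ → Set
EdgeDist G v x y d = IsMin (λ m → Dist G v x m ⊎ Dist G v y m) d

ClassDist : (G : Graph) {k : ℕ} → Coloring G k → Fin (V G) → Fin k → ℕ → Set
ClassDist G c v i d =
  IsMin (λ m → Σ (Fin (V G)) λ x → Σ (Fin (V G)) λ y →
                 Adj G x y × c x y ≡ i × EdgeDist G v x y m) d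

SameCode : (G : Graph) {k : ℕ} → Coloring G k → Fin (V G) → Fin (V G) → Set
SameCode G c u v = ∀ i d →
  (ClassDist G c u i d → ClassDist G c v i d) ×
  (ClassDist G c v i d → ClassDist G c u i d)

record IsEdgeLocating (G : Graph) (k : ℕ) (c : Coloring G k) : Set where
  field
    symmetric : ∀ x y → Adj G x y → c x y ≡ c y x
    proper    : ∀ x y z → Adj G x y → Adj G x z → y ≢ z → c x y ≢ c x z
    -- π = (𝒞_1,…,𝒞_k) is a partition into k (nonempty) color classes
    onto      : ∀ i → Σ (Fin (V G)) λ x → Σ (Fin (V G)) λ y →
                  Adj G x y × c x y ≡ i
    locating  : ∀ u v → SameCode G c u v → u ≡ v

HasEdgeLocating : Graph → ℕ → Set
HasEdgeLocating G k = Σ (Coloring G k) (IsEdgeLocating G k)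

EdgeLocChromatic : Graph → ℕ → Set
EdgeLocChromatic G k = HasEdgeLocating G k × (∀ m → HasEdgeLocating G m → k ≤ m)

{-# OPTIONS --safe #-}
module Submission where

-- A vertex adjacent to all n other vertices sees n distinct colours; if only n
-- colours are used it sees all of them, so each of its neighbours is within distance one of
-- every colour class and its code only records which colours it sees.  Two such dominating
-- vertices (the hubs of a book, two vertices of F₂ or F₃) therefore share a code, and for Wm(2)
-- a short case analysis finds two leaves seeing the same two colours.
--
-- The colour classes at distance 0 from v are exactly the colours v sees, so a
-- proper colouring in which distinct vertices see distinct sets of colours is locating.  Wheels,
-- fans and windmills are K₁ + H with H a spanning subgraph of an N-cycle, N ≥ 5.  Colour the
-- spoke to i with i and the cycle edge from i to i + 1 with i + 2 (mod N): rim vertex i sees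
-- only colours among i, i + 1, i + 2, so it misses i + 3, which the centre sees, and two rim
-- vertices seeing each other's spoke colours would be at most two steps apart in both directions
-- around the cycle.  Books get an explicit colouring; the small cases are checked by evaluation.

open import Defs
open import Data.Bool using (true; false; not; _∧_; _∨_; T; if_then_else_)
open import Data.Bool.Properties using (∨-comm; T-≡; T-∨; T-∧; T-not-≡) renaming (_≟_ to _≟ᵇ_)
open import Data.Empty using (⊥; ⊥-elim)
open import Data.Fin using (Fin; zero; suc; toℕ; fromℕ<; splitAt; punchIn; punchOut; #_)
open import Data.Fin.Properties
  using (any?; all?; injective⇒≤; punchIn-injective; punchInᵢ≢i; punchOut-injective;
         toℕ<n; toℕ-injective; toℕ-fromℕ<; fromℕ<-cong)
  renaming (_≟_ to _≟ᶠ_)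
open import Data.Nat
  using (ℕ; zero; suc; pred; _+_; _*_; _∸_; _/_; _⊓_; _⊔_; _≡ᵇ_; _≤_; _<_; _<?_; z≤n; s≤s)
open import Data.Nat.DivMod using (m/n≡1+[m∸n]/n)
open import Data.Nat.Properties
  using (_≟_; ≤-refl; ≤-trans; <⇒≤; ≤-antisym; ≤⇒≯; ≮⇒≥; ≤∧≢⇒<; m≤n⇒m<n∨m≡n;
         1+n≰n; 0≢1+n; 1+n≢0; 1+n≢n; m≢1+n+m; suc-injective; n≤1+n; m<n⇒m<1+n; m≤m+n; m≤n+m;
         +-assoc; +-comm; +-identityʳ; +-cancelˡ-≡; +-cancelʳ-≡; +-mono-≤; +-mono-<-≤; m+n≡0⇒m≡0;
         m∸n+n≡m; m+n∸n≡m; ∸-monoˡ-<; *-comm; *-monoˡ-≤; ≡ᵇ⇒≡; ≡⇒≡ᵇ; +-commutativeSemigroup)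
open import Algebra.Properties.CommutativeSemigroup +-commutativeSemigroup
  using (xy∙z≈xz∙y; interchange)
open import Data.Product using (∃-syntax; _×_; _,_; proj₁; proj₂)
open import Data.Sum using (_⊎_; inj₁; inj₂; map)
open import Function using (_∘_; _⇔_; mk⇔; Equivalence)
open import Function.Definitions using (Injective)
open import Relation.Nullary using (¬_; Dec; yes; no; does)
open import Relation.Nullary.Decidable
  using (True; toWitness; map′; _×-dec_; _⊎-dec_; _→-dec_; ¬?; dec-true; dec-false)
open import Relation.Binary.PropositionalEquality
  using (_≡_; _≢_; refl; sym; trans; cong; cong₂; subst; module ≡-Reasoning)

Symmetric : Graph → Set
Symmetric G = ∀ x y → adj G x y ≡ adj G y x

adj? : ∀ G x y → Dec (Adj G x y)
adj? G x y = adj G x y ≟ᵇ true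

adj-sym : ∀ {G} → Symmetric G → ∀ {x y} → Adj G x y → Adj G y x
adj-sym sG {x} {y} a = trans (sym (sG x y)) a

≡ᵇ-sym : ∀ m n → (m ≡ᵇ n) ≡ (n ≡ᵇ m)
≡ᵇ-sym zero    zero    = refl
≡ᵇ-sym zero    (suc n) = refl
≡ᵇ-sym (suc m) zero    = refl
≡ᵇ-sym (suc m) (suc n) = ≡ᵇ-sym m n

join-symmetric : ∀ G H → Symmetric G → Symmetric H → Symmetric (G ⊕ H)
join-symmetric G H sG sH x y with splitAt (V G) x | splitAt (V G) y
... | inj₁ a | inj₁ b = sG a b
... | inj₁ _ | inj₂ _ = refl
... | inj₂ _ | inj₁ _ = refl
... | inj₂ a | inj₂ b = sH a b

K1-symmetric : Symmetric K1
K1-symmetric _ _ = refl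

apex-symmetric : ∀ H → Symmetric H → Symmetric (K1 ⊕ H)
apex-symmetric H = join-symmetric K1 H K1-symmetric

K2-symmetric : Symmetric K2
K2-symmetric i j = cong not (≡ᵇ-sym (toℕ i) (toℕ j))

P-symmetric : ∀ n → Symmetric (P n)
P-symmetric n i j = ∨-comm (toℕ j ≡ᵇ suc (toℕ i)) _

C-symmetric : ∀ n → Symmetric (C n)
C-symmetric n i j =
  cong₂ _∨_ (P-symmetric n i j) (∨-comm ((toℕ i ≡ᵇ 0) ∧ (suc (toℕ j) ≡ᵇ n)) _)

nK2-symmetric : ∀ n → Symmetric (nK2 n)
nK2-symmetric n i j =
  cong₂ _∧_ (≡ᵇ-sym (toℕ i / 2) (toℕ j / 2)) (cong not (≡ᵇ-sym (toℕ i) (toℕ j)))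

-- Colours seen by a vertex, and distances to colour classes

module _ (G : Graph) {A : Set} (c : Fin (V G) → Fin (V G) → A) where

  Incident : Fin (V G) → A → Set
  Incident v a = ∃[ y ] Adj G v y × c v y ≡ a

  SameIncidence : Fin (V G) → Fin (V G) → Set
  SameIncidence u w = ∀ a → Incident u a ⇔ Incident w a

  sameIncidence-sym : ∀ {u w} → SameIncidence u w → SameIncidence w u
  sameIncidence-sym same a = mk⇔ (Equivalence.from (same a)) (Equivalence.to (same a))

isMin-zero : ∀ {P : ℕ → Set} → P 0 → IsMin P 0
isMin-zero p = p , λ _ _ → z≤n

isMin-one : ∀ {P : ℕ → Set} → P 1 → ¬ P 0 → IsMin P 1
isMin-one p ¬p₀ = p , λ where
  zero    p₀ → ⊥-elim (¬p₀ p₀)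
  (suc _) _  → s≤s z≤n

isMin-unique : ∀ {P d d′} → IsMin P d → IsMin P d′ → d ≡ d′
isMin-unique (p , min) (p′ , min′) = ≤-antisym (min _ p′) (min′ _ p)

walk-length-0 : ∀ {G x y} → Walk G x y 0 → x ≡ y
walk-length-0 here = refl

module _ (G : Graph) {k : ℕ} (c : Coloring G k) where

  incident? : ∀ v i → Dec (Incident G c v i)
  incident? v i = any? λ y → adj? G v y ×-dec (c v y ≟ᶠ i)

  incident⇒classDist≡0 : ∀ {v i} → Incident G c v i → ClassDist G c v i 0
  incident⇒classDist≡0 {v} (y , a , e) =
    isMin-zero (v , y , a , e , isMin-zero (inj₁ (isMin-zero here)))

  module _ (sG : Symmetric G) (c-sym : ∀ x y → Adj G x y → c x y ≡ c y x) where

    endpoint-incident : ∀ {v x y i} → Adj G x y → c x y ≡ i →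
                        Dist G v x 0 ⊎ Dist G v y 0 → Incident G c v i
    endpoint-incident a e (inj₁ (w , _)) with walk-length-0 w
    ... | refl = _ , a , e
    endpoint-incident {x = x} {y} a e (inj₂ (w , _)) with walk-length-0 w
    ... | refl = x , adj-sym sG a , trans (sym (c-sym x y a)) e

    classDist≡0⇒incident : ∀ {v i} → ClassDist G c v i 0 → Incident G c v i
    classDist≡0⇒incident ((_ , _ , a , e , d₀ , _) , _) = endpoint-incident a e d₀

    classDist≡1 : ∀ {v z i} → ¬ Incident G c v i → Adj G v z → Incident G c z i →
                  ClassDist G c v i 1
    classDist≡1 {v} {z} ¬inc v~z (y , z~y , e) =
      isMin-one (z , y , z~y , e , isMin-one dist-z (¬inc ∘ endpoint-incident z~y e))
                (λ (_ , _ , a , e′ , d₀) → ¬inc (endpoint-incident a e′ (proj₁ d₀)))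
      where
      dist-z : Dist G v z 1 ⊎ Dist G v y 1
      dist-z = inj₁ (isMin-one (step v~z here) λ w →
        ¬inc (subst (λ u → Incident G c u _) (sym (walk-length-0 w)) (y , z~y , e)))

    sameCode⇒sameIncidence : ∀ {u w} → SameCode G c u w → SameIncidence G c u w
    sameCode⇒sameIncidence same i = mk⇔
      (classDist≡0⇒incident ∘ proj₁ (same i 0) ∘ incident⇒classDist≡0)
      (classDist≡0⇒incident ∘ proj₂ (same i 0) ∘ incident⇒classDist≡0)

    locating-by-incidence : (∀ u w → SameIncidence G c u w → u ≡ w) →
                            ∀ u w → SameCode G c u w → u ≡ w
    locating-by-incidence separates u w = separates u w ∘ sameCode⇒sameIncidence

  WithinOne : Fin (V G) → Set
  WithinOne v = ∀ i → ¬ Incident G c v i → ClassDist G c v i 1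

  sameIncidence⇒sameCode : ∀ {u w} → WithinOne u → WithinOne w →
                           SameIncidence G c u w → SameCode G c u w
  sameIncidence⇒sameCode near-u near-w same i d =
    transfer near-u near-w same , transfer near-w near-u (sameIncidence-sym G c same)
    where
    transfer : ∀ {u w} → WithinOne u → WithinOne w → SameIncidence G c u w →
               ClassDist G c u i d → ClassDist G c w i d
    transfer {u} {w} near-u near-w same du with incident? u i
    ... | yes inc = subst (ClassDist G c w i) (isMin-unique (incident⇒classDist≡0 inc) du)
                      (incident⇒classDist≡0 (Equivalence.to (same i) inc))
    ... | no ¬inc = subst (ClassDist G c w i) (isMin-unique (near-u i ¬inc) du)
                      (near-w i (¬inc ∘ Equivalence.from (same i)))

-- Lower bounds

Dominating : (G : Graph) → Fin (V G) → Set
Dominating G x = ∀ y → x ≢ y → Adj G x y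

dominating? : ∀ G x → Dec (Dominating G x)
dominating? G x = all? λ y → ¬? (x ≟ᶠ y) →-dec adj? G x y

record Star (G : Graph) (x : Fin (V G)) (n : ℕ) : Set where
  field
    leaf           : Fin n → Fin (V G)
    leaf-injective : Injective _≡_ _≡_ leaf
    leaf-adjacent  : ∀ j → Adj G x (leaf j)

dominating⇒star : ∀ G x → Dominating G x → Star G x (pred (V G))
dominating⇒star record { V = suc _ } x dom = record
  { leaf           = punchIn x
  ; leaf-injective = punchIn-injective x _ _
  ; leaf-adjacent  = λ j → dom _ (punchInᵢ≢i x j ∘ sym)
  }

Fin-injective⇒surjective : ∀ {m} {f : Fin m → Fin m} → Injective _≡_ _≡_ f →
                           ∀ i → ∃[ j ] f j ≡ i
Fin-injective⇒surjective {suc m} {f} f-inj i with any? (λ j → f j ≟ᶠ i)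
... | yes hit = hit
... | no miss = ⊥-elim (1+n≰n (injective⇒≤ punchOut-f-injective))
  where
  missed : ∀ j → i ≢ f j
  missed j i≡fj = miss (j , sym i≡fj)
  punchOut-f-injective : Injective _≡_ _≡_ (λ j → punchOut (missed j))
  punchOut-f-injective {j} {j′} = f-inj ∘ punchOut-injective (missed j) (missed j′)

module _ {G : Graph} {m : ℕ} (E : HasEdgeLocating G m) where
  private
    c : Coloring G m
    c = proj₁ E
    open IsEdgeLocating (proj₂ E)

  star-colours-injective : ∀ {x n} (s : Star G x n) → Injective _≡_ _≡_ (c x ∘ Star.leaf s)
  star-colours-injective {x} s {j} {j′} e with Star.leaf s j ≟ᶠ Star.leaf s j′
  ... | yes same-leaf = Star.leaf-injective s same-leaf
  ... | no  ≢leaf     =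
    ⊥-elim (proper x _ _ (Star.leaf-adjacent s j) (Star.leaf-adjacent s j′) ≢leaf e)

  star⇒≤ : ∀ {x n} → Star G x n → n ≤ m
  star⇒≤ s = injective⇒≤ (star-colours-injective s)

  star⇒incident-all : ∀ {x} → Star G x m → ∀ i → Incident G c x i
  star⇒incident-all s i with Fin-injective⇒surjective (star-colours-injective s) i
  ... | j , e = Star.leaf s j , Star.leaf-adjacent s j , e

  two-stars⇒< : ∀ {x y n} → x ≢ y → Star G x n → Star G y n → n < m
  two-stars⇒< {x} {y} {n} x≢y sx sy = ≤∧≢⇒< (star⇒≤ sx) n≢m
    where
    n≢m : n ≢ m
    n≢m refl = x≢y (locating x y (sameIncidence⇒sameCode G c (near sx) (near sy)
      λ i → mk⇔ (λ _ → star⇒incident-all sy i) (λ _ → star⇒incident-all sx i)))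
      where
      near : ∀ {v} → Star G v n → WithinOne G c v
      near s i ¬inc = ⊥-elim (¬inc (star⇒incident-all s i))

apex-dominating : ∀ H → Dominating (K1 ⊕ H) zero
apex-dominating H zero    0≢0 = ⊥-elim (0≢0 refl)
apex-dominating H (suc j) _   = refl

NeighbourPair : (G : Graph) → Fin (V G) → Fin (V G) → Fin (V G) → Set
NeighbourPair G u z p = Adj G u z × Adj G u p × (∀ y → Adj G u y → y ≡ z ⊎ y ≡ p)

neighbourPair? : ∀ G u z p → Dec (NeighbourPair G u z p)
neighbourPair? G u z p =
  adj? G u z ×-dec adj? G u p ×-dec all? (λ y → adj? G u y →-dec ((y ≟ᶠ z) ⊎-dec (y ≟ᶠ p)))

module _ (G : Graph) {A : Set} (c : Fin (V G) → Fin (V G) → A) where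

  incidence-of-neighbourPair : ∀ {u z p} → NeighbourPair G u z p →
                               ∀ a → Incident G c u a ⇔ (c u z ≡ a ⊎ c u p ≡ a)
  incidence-of-neighbourPair {u} {z} {p} (u~z , u~p , only) a = mk⇔ to from
    where
    to : Incident G c u a → c u z ≡ a ⊎ c u p ≡ a
    to (y , u~y , e) with only y u~y
    ... | inj₁ refl = inj₁ e
    ... | inj₂ refl = inj₂ e
    from : c u z ≡ a ⊎ c u p ≡ a → Incident G c u a
    from (inj₁ e) = z , u~z , e
    from (inj₂ e) = p , u~p , e

  crossed⇒sameIncidence : ∀ {u w z p q} → NeighbourPair G u z p → NeighbourPair G w z q →
                          c u z ≡ c w q → c u p ≡ c w z → SameIncidence G c u w
  crossed⇒sameIncidence {u} {w} {z} {p} {q} nu nw uz≡wq up≡wz a = mk⇔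
    (from-w ∘ cross ∘ to-u) (from-u ∘ uncross ∘ to-w)
    where
    open Equivalence (incidence-of-neighbourPair nu a) renaming (to to to-u; from to from-u)
    open Equivalence (incidence-of-neighbourPair nw a) renaming (to to to-w; from to from-w)
    cross : c u z ≡ a ⊎ c u p ≡ a → c w z ≡ a ⊎ c w q ≡ a
    cross (inj₁ e) = inj₂ (trans (sym uz≡wq) e)
    cross (inj₂ e) = inj₁ (trans (sym up≡wz) e)
    uncross : c w z ≡ a ⊎ c w q ≡ a → c u z ≡ a ⊎ c u p ≡ a
    uncross (inj₁ e) = inj₂ (trans up≡wz e)
    uncross (inj₂ e) = inj₁ (trans uz≡wq e)

-- The centre sees all four colours, so edge 12 has the colour of the spoke to 3 or 4 and edge
-- 34 that of the spoke to 1 or 2; the leaves at the ends of these two spokes see the same pair.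
module Windmill₂ (E : HasEdgeLocating (Windmill 2) 4) where
  private
    G : Graph
    G = Windmill 2
    c : Coloring G 4
    c = proj₁ E
    open IsEdgeLocating (proj₂ E)
    s₂₁ : c (# 2) (# 1) ≡ c (# 1) (# 2)
    s₂₁ = symmetric (# 2) (# 1) refl
    s₃₄ : c (# 3) (# 4) ≡ c (# 4) (# 3)
    s₃₄ = symmetric (# 3) (# 4) refl

  centre-full : ∀ i → Incident G c zero i
  centre-full = star⇒incident-all E (dominating⇒star G zero (apex-dominating (nK2 2)))

  pair₁₂-colour : c (# 1) (# 2) ≡ c zero (# 3) ⊎ c (# 1) (# 2) ≡ c zero (# 4)
  pair₁₂-colour with centre-full (c (# 1) (# 2))
  ... | suc zero , _ , e =
    ⊥-elim (proper (# 1) zero (# 2) refl refl (λ ()) (trans (symmetric (# 1) zero refl) e))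
  ... | suc (suc zero) , _ , e =
    ⊥-elim (proper (# 2) zero (# 1) refl refl (λ ())
      (trans (symmetric (# 2) zero refl) (trans e (symmetric (# 1) (# 2) refl))))
  ... | suc (suc (suc zero)) , _ , e = inj₁ (sym e)
  ... | suc (suc (suc (suc zero))) , _ , e = inj₂ (sym e)

  pair₃₄-colour : c (# 3) (# 4) ≡ c zero (# 1) ⊎ c (# 3) (# 4) ≡ c zero (# 2)
  pair₃₄-colour with centre-full (c (# 3) (# 4))
  ... | suc zero , _ , e = inj₁ (sym e)
  ... | suc (suc zero) , _ , e = inj₂ (sym e)
  ... | suc (suc (suc zero)) , _ , e =
    ⊥-elim (proper (# 3) zero (# 4) refl refl (λ ()) (trans (symmetric (# 3) zero refl) e))
  ... | suc (suc (suc (suc zero))) , _ , e =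
    ⊥-elim (proper (# 4) zero (# 3) refl refl (λ ())
      (trans (symmetric (# 4) zero refl) (trans e (symmetric (# 3) (# 4) refl))))

  leaves-not-crossed : ∀ u p w q →
                       {True (neighbourPair? G u zero p)} → {True (neighbourPair? G w zero q)} →
                       u ≢ w → c zero u ≡ c w q → c u p ≡ c zero w → ⊥
  leaves-not-crossed u p w q {nu} {nw} u≢w uz≡wq up≡wz =
    u≢w (locating u w (sameIncidence⇒sameCode G c (near-centre nu′) (near-centre nw′)
      (crossed⇒sameIncidence G c nu′ nw′
        (trans (symmetric u zero (proj₁ nu′)) uz≡wq)
        (trans up≡wz (symmetric zero w (adj-sym sG {w} {zero} (proj₁ nw′)))))))
    where
    nu′ : NeighbourPair G u zero p
    nu′ = toWitness nu
    nw′ : NeighbourPair G w zero q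
    nw′ = toWitness nw
    sG : Symmetric G
    sG = apex-symmetric (nK2 2) (nK2-symmetric 2)
    near-centre : ∀ {v z} → NeighbourPair G v zero z → WithinOne G c v
    near-centre (v~0 , _) i ¬inc = classDist≡1 G c sG symmetric ¬inc v~0 (centre-full i)

  no-4-colouring : ⊥
  no-4-colouring with pair₁₂-colour | pair₃₄-colour
  ... | inj₁ e₁₂ | inj₁ e₃₄ =
    leaves-not-crossed (# 1) (# 2) (# 3) (# 4) (λ ()) (sym e₃₄) e₁₂
  ... | inj₁ e₁₂ | inj₂ e₃₄ =
    leaves-not-crossed (# 2) (# 1) (# 3) (# 4) (λ ()) (sym e₃₄) (trans s₂₁ e₁₂)
  ... | inj₂ e₁₂ | inj₁ e₃₄ =
    leaves-not-crossed (# 1) (# 2) (# 4) (# 3) (λ ()) (trans (sym e₃₄) s₃₄) e₁₂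
  ... | inj₂ e₁₂ | inj₂ e₃₄ =
    leaves-not-crossed (# 2) (# 1) (# 4) (# 3) (λ ()) (trans (sym e₃₄) s₃₄) (trans s₂₁ e₁₂)

-- Upper bounds

module _ {G : Graph} (sG : Symmetric G) {k : ℕ} (c : Coloring G k) where

  symmetric? : Dec (∀ x y → Adj G x y → c x y ≡ c y x)
  symmetric? = all? λ x → all? λ y → adj? G x y →-dec (c x y ≟ᶠ c y x)

  proper? : Dec (∀ x y z → Adj G x y → Adj G x z → ¬ y ≡ z → ¬ c x y ≡ c x z)
  proper? = all? λ x → all? λ y → all? λ z →
    adj? G x y →-dec adj? G x z →-dec ¬? (y ≟ᶠ z) →-dec ¬? (c x y ≟ᶠ c x z)

  onto? : Dec (∀ i → ∃[ x ] ∃[ y ] Adj G x y × c x y ≡ i)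
  onto? = all? λ i → any? λ x → any? λ y → adj? G x y ×-dec (c x y ≟ᶠ i)

  sameIncidence? : ∀ u w → Dec (SameIncidence G c u w)
  sameIncidence? u w = all? λ i →
    map′ (λ (to , from) → mk⇔ to from) (λ e → Equivalence.to e , Equivalence.from e)
      ((incident? G c u i →-dec incident? G c w i) ×-dec
       (incident? G c w i →-dec incident? G c u i))

  separating? : Dec (∀ u w → SameIncidence G c u w → u ≡ w)
  separating? = all? λ u → all? λ w → sameIncidence? u w →-dec (u ≟ᶠ w)

  edgeLocating-by-decision : True (symmetric? ×-dec proper? ×-dec onto? ×-dec separating?) →
                             HasEdgeLocating G k
  edgeLocating-by-decision ok with toWitness ok
  ... | c-sym , c-proper , c-onto , separating = c , record
    { symmetric = c-sym
    ; proper    = c-proper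
    ; onto      = c-onto
    ; locating  = locating-by-incidence G c sG c-sym separating
    }

record IsSeparatingℕ (G : Graph) (k : ℕ) (col : Fin (V G) → Fin (V G) → ℕ) : Set where
  field
    bounded    : ∀ x y → col x y < k
    symmetric  : ∀ x y → Adj G x y → col x y ≡ col y x
    proper     : ∀ x y z → Adj G x y → Adj G x z → col x y ≡ col x z → y ≡ z
    onto       : ∀ i → i < k → ∃[ x ] Incident G col x i
    separating : ∀ u w → SameIncidence G col u w → u ≡ w

module _ {G : Graph} (sG : Symmetric G) {k : ℕ} {col : Fin (V G) → Fin (V G) → ℕ}
         (L : IsSeparatingℕ G k col) where
  open IsSeparatingℕ L

  private
    c : Coloring G k
    c x y = fromℕ< (bounded x y)

    toℕ-c : ∀ x y → toℕ (c x y) ≡ col x y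
    toℕ-c x y = toℕ-fromℕ< (bounded x y)

    c-sym : ∀ x y → Adj G x y → c x y ≡ c y x
    c-sym x y a = fromℕ<-cong _ _ (symmetric x y a) (bounded x y) (bounded y x)

    incident-toℕ : ∀ {v i} → Incident G c v i → Incident G col v (toℕ i)
    incident-toℕ (y , a , e) = y , a , trans (sym (toℕ-c _ y)) (cong toℕ e)

  edgeLocating-fromℕ : HasEdgeLocating G k
  edgeLocating-fromℕ = c , record
    { symmetric = c-sym
    ; proper    = λ x y z x~y x~z y≢z e → y≢z (proper x y z x~y x~z
                    (trans (sym (toℕ-c x y)) (trans (cong toℕ e) (toℕ-c x z))))
    ; onto      = λ i → let (x , y , a , e) = onto (toℕ i) (toℕ<n i)
                        in x , y , a , toℕ-injective (trans (toℕ-c x y) e)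
    ; locating  = locating-by-incidence G c sG c-sym λ u w same → separating u w λ i →
                    mk⇔ (transfer same) (transfer (sameIncidence-sym G c same))
    }
    where
    transfer : ∀ {u w i} → SameIncidence G c u w → Incident G col u i → Incident G col w i
    transfer {u} {w} same (y , a , e) = subst (Incident G col w) (trans (toℕ-c u y) e)
      (incident-toℕ (Equivalence.to (same _) (y , a , refl)))

module CyclicSteps (N : ℕ) where

  Wrap : ℕ → Set
  Wrap e = e ≡ 0 ⊎ e ≡ N

  -- x ≡ a + d (mod N), for residues a, x < N and d ≤ N
  record _⇝[_]_ (a d x : ℕ) : Set where
    constructor wrapping
    field
      excess       : ℕ
      excess-wraps : Wrap excess
      balance      : x + excess ≡ a + d

  small≢wrapped : ∀ {u v} → u < N → u + 0 ≢ v + N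
  small≢wrapped {u} {v} u<N eq =
    ≤⇒≯ (m≤n+m N v) (subst (_< N) (trans (sym (+-identityʳ u)) eq) u<N)

  unwrap : ∀ {u v e₁ e₂} → u < N → v < N → Wrap e₁ → Wrap e₂ → u + e₁ ≡ v + e₂ → u ≡ v
  unwrap {u} {v} _   _   (inj₁ refl) (inj₁ refl) eq = +-cancelʳ-≡ 0 u v eq
  unwrap         u<N _   (inj₁ refl) (inj₂ refl) eq = ⊥-elim (small≢wrapped u<N eq)
  unwrap         _   v<N (inj₂ refl) (inj₁ refl) eq = ⊥-elim (small≢wrapped v<N (sym eq))
  unwrap {u} {v} _   _   (inj₂ refl) (inj₂ refl) eq = +-cancelʳ-≡ N u v eq

  common-target : ∀ {x e₁ e₂ y₁ y₂} → x + e₁ ≡ y₁ → x + e₂ ≡ y₂ → y₁ + e₂ ≡ y₂ + e₁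
  common-target {x} {e₁} {e₂} refl refl = xy∙z≈xz∙y x e₁ e₂

  ⇝-refl : ∀ {a} → a ⇝[ 0 ] a
  ⇝-refl = wrapping 0 (inj₁ refl) refl

  succ⇒⇝ : ∀ {a b} → suc a ≡ b → a ⇝[ 1 ] b
  succ⇒⇝ {a} refl = wrapping 0 (inj₁ refl) (trans (+-identityʳ (suc a)) (+-comm 1 a))

  ⇝-steps-unique : ∀ {a d₁ d₂ x} → d₁ < N → d₂ < N → a ⇝[ d₁ ] x → a ⇝[ d₂ ] x → d₁ ≡ d₂
  ⇝-steps-unique {a} {d₁} {d₂} d₁<N d₂<N (wrapping e₁ w₁ p) (wrapping e₂ w₂ q) =
    unwrap d₁<N d₂<N w₂ w₁ (+-cancelˡ-≡ a _ _ (begin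
      a + (d₁ + e₂)  ≡⟨ +-assoc a d₁ e₂ ⟨
      a + d₁ + e₂    ≡⟨ common-target p q ⟩
      a + d₂ + e₁    ≡⟨ +-assoc a d₂ e₁ ⟩
      a + (d₂ + e₁)  ∎))
    where open ≡-Reasoning

  ⇝-target-unique : ∀ {a d x y} → x < N → y < N → a ⇝[ d ] x → a ⇝[ d ] y → x ≡ y
  ⇝-target-unique x<N y<N (wrapping _ w₁ p) (wrapping _ w₂ q) =
    unwrap x<N y<N w₁ w₂ (trans p (sym q))

  ⇝-source-unique : ∀ {a b d x} → a < N → b < N → a ⇝[ d ] x → b ⇝[ d ] x → a ≡ b
  ⇝-source-unique {a} {b} {d} a<N b<N (wrapping e₁ w₁ p) (wrapping e₂ w₂ q) =
    unwrap a<N b<N w₂ w₁ (+-cancelʳ-≡ d _ _ (begin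
      a + e₂ + d  ≡⟨ xy∙z≈xz∙y a e₂ d ⟩
      a + d + e₂  ≡⟨ common-target p q ⟩
      b + d + e₁  ≡⟨ xy∙z≈xz∙y b d e₁ ⟩
      b + e₁ + d  ∎))
    where open ≡-Reasoning

  ⇝-round-trip : ∀ {a b d₁ d₂} → d₁ + d₂ < N → a ⇝[ d₁ ] b → b ⇝[ d₂ ] a → a ≡ b
  ⇝-round-trip {a} {b} {d₁} {d₂} short (wrapping e₁ w₁ p) (wrapping e₂ w₂ q) =
    no-wraps w₁ w₂ p wraps≡steps
    where
    open ≡-Reasoning
    wraps≡steps : e₁ + e₂ ≡ d₁ + d₂
    wraps≡steps = +-cancelˡ-≡ (a + b) _ _ (begin
      a + b + (e₁ + e₂)  ≡⟨ cong (_+ (e₁ + e₂)) (+-comm a b) ⟩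
      b + a + (e₁ + e₂)  ≡⟨ interchange b e₁ a e₂ ⟨
      b + e₁ + (a + e₂)  ≡⟨ cong₂ _+_ p q ⟩
      a + d₁ + (b + d₂)  ≡⟨ interchange a d₁ b d₂ ⟩
      a + b + (d₁ + d₂)  ∎)
    no-wraps : ∀ {e₁ e₂} → Wrap e₁ → Wrap e₂ → b + e₁ ≡ a + d₁ → e₁ + e₂ ≡ d₁ + d₂ → a ≡ b
    no-wraps (inj₁ refl) (inj₁ refl) p sum = begin
      a       ≡⟨ +-identityʳ a ⟨
      a + 0   ≡⟨ cong (a +_) (m+n≡0⇒m≡0 d₁ (sym sum)) ⟨
      a + d₁  ≡⟨ p ⟨
      b + 0   ≡⟨ +-identityʳ b ⟩
      b       ∎
    no-wraps {e₂ = e₂} (inj₂ refl) _ _ sum =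
      ⊥-elim (≤⇒≯ (m≤m+n N e₂) (subst (_< N) (sym sum) short))
    no-wraps (inj₁ refl) (inj₂ refl) _ sum =
      ⊥-elim (≤⇒≯ (m≤n+m N 0) (subst (_< N) (sym sum) short))

  ⇝-trans : ∀ {a b x d d′} → a < N → d + d′ ≤ N → a ⇝[ d ] b → b ⇝[ d′ ] x → a ⇝[ d + d′ ] x
  ⇝-trans {a} {b} {x} {d} {d′} a<N d+d′≤N (wrapping e₁ w₁ p) (wrapping e₂ w₂ q) =
    wrapping (e₂ + e₁) (sum-wrap w₂ w₁ x+e≡) x+e≡
    where
    open ≡-Reasoning
    x+e≡ : x + (e₂ + e₁) ≡ a + (d + d′)
    x+e≡ = begin
      x + (e₂ + e₁)  ≡⟨ +-assoc x e₂ e₁ ⟨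
      x + e₂ + e₁    ≡⟨ cong (_+ e₁) q ⟩
      b + d′ + e₁    ≡⟨ xy∙z≈xz∙y b d′ e₁ ⟩
      b + e₁ + d′    ≡⟨ cong (_+ d′) p ⟩
      a + d + d′     ≡⟨ +-assoc a d d′ ⟩
      a + (d + d′)   ∎
    sum-wrap : ∀ {e₂ e₁} → Wrap e₂ → Wrap e₁ → x + (e₂ + e₁) ≡ a + (d + d′) → Wrap (e₂ + e₁)
    sum-wrap (inj₁ refl) w₁ _ = w₁
    sum-wrap (inj₂ refl) (inj₁ refl) _ = inj₂ (+-identityʳ N)
    sum-wrap (inj₂ refl) (inj₂ refl) eq =
      ⊥-elim (≤⇒≯ (subst (N + N ≤_) eq (m≤n+m (N + N) x)) (+-mono-<-≤ a<N d+d′≤N))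

  _+ᶜ_ : ℕ → ℕ → ℕ
  a +ᶜ d with a + d <? N
  ... | yes _ = a + d
  ... | no  _ = a + d ∸ N

  +ᶜ-⇝ : ∀ a d → a ⇝[ d ] (a +ᶜ d)
  +ᶜ-⇝ a d with a + d <? N
  ... | yes _  = wrapping 0 (inj₁ refl) (+-identityʳ (a + d))
  ... | no  ≮N = wrapping N (inj₂ refl) (m∸n+n≡m (≮⇒≥ ≮N))

  +ᶜ-< : ∀ {a d} → a < N → d ≤ N → a +ᶜ d < N
  +ᶜ-< {a} {d} a<N d≤N with a + d <? N
  ... | yes <N = <N
  ... | no  ≮N = subst (a + d ∸ N <_) (m+n∸n≡m N N) (∸-monoˡ-< (+-mono-<-≤ a<N d≤N) (≮⇒≥ ≮N))

  module _ (2<N : 2 < N) where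

    -- on an edge of the N-cycle: the successor of its later endpoint
    edgeColour : ℕ → ℕ → ℕ
    edgeColour a b = if does (b ≟ a +ᶜ 1) then b +ᶜ 1 else a +ᶜ 1

    private
      0<N : 0 < N
      0<N = ≤-trans (s≤s z≤n) 2<N
      1<N : 1 < N
      1<N = ≤-trans (s≤s (s≤s z≤n)) 2<N

    edgeColour-succ : ∀ {a b} → a < N → b < N → a ⇝[ 1 ] b → edgeColour a b ≡ b +ᶜ 1
    edgeColour-succ {a} {b} a<N b<N a⇝b
      rewrite dec-true (b ≟ a +ᶜ 1) (⇝-target-unique b<N (+ᶜ-< a<N (<⇒≤ 1<N)) a⇝b (+ᶜ-⇝ a 1)) = refl

    ⇝-no-2-cycle : ∀ {a b} → a ⇝[ 1 ] b → b ⇝[ 1 ] a → ⊥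
    ⇝-no-2-cycle {a} a⇝b b⇝a with ⇝-round-trip 2<N a⇝b b⇝a
    ... | refl with () ← ⇝-steps-unique 0<N 1<N (⇝-refl {a}) a⇝b

    predecessor≢successor : ∀ {a b} → a ⇝[ 1 ] b → a ≢ b +ᶜ 1
    predecessor≢successor {b = b} a⇝b a≡b+1 =
      ⇝-no-2-cycle a⇝b (subst (b ⇝[ 1 ]_) (sym a≡b+1) (+ᶜ-⇝ b 1))

    edgeColour-pred : ∀ {a b} → a ⇝[ 1 ] b → edgeColour b a ≡ b +ᶜ 1
    edgeColour-pred {a} {b} a⇝b rewrite dec-false (a ≟ b +ᶜ 1) (predecessor≢successor a⇝b) = refl

    edgeColour-< : ∀ {a b} → a < N → b < N → edgeColour a b < N
    edgeColour-< {a} {b} a<N b<N with does (b ≟ a +ᶜ 1)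
    ... | true  = +ᶜ-< b<N (<⇒≤ 1<N)
    ... | false = +ᶜ-< a<N (<⇒≤ 1<N)

SubgraphOfCycle : Graph → Set
SubgraphOfCycle H = ∀ i j → Adj H i j → toℕ i ⇝[ 1 ] toℕ j ⊎ toℕ j ⇝[ 1 ] toℕ i
  where open CyclicSteps (V H)

module ApexColouring (H : Graph) (5≤N : 5 ≤ V H) (cycle : SubgraphOfCycle H) where
  open CyclicSteps (V H)

  private
    N : ℕ
    N = V H
    G : Graph
    G = K1 ⊕ H
    small<N : ∀ {d} → d ≤ 4 → d < N
    small<N d≤4 = ≤-trans (s≤s d≤4) 5≤N
    0<N : 0 < N
    0<N = small<N z≤n
    1<N : 1 < N
    1<N = small<N (s≤s z≤n)
    2<N : 2 < N
    2<N = small<N (s≤s (s≤s z≤n))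
    3<N : 3 < N
    3<N = small<N (s≤s (s≤s (s≤s z≤n)))

  colour : Fin (V G) → Fin (V G) → ℕ
  colour zero    zero    = 0
  colour zero    (suc j) = toℕ j
  colour (suc i) zero    = toℕ i
  colour (suc i) (suc j) = edgeColour 2<N (toℕ i) (toℕ j)

  rim-forward : ∀ {i j} → toℕ i ⇝[ 1 ] toℕ j → toℕ i ⇝[ 2 ] colour (suc i) (suc j)
  rim-forward {i} {j} i⇝j =
    subst (toℕ i ⇝[ 2 ]_) (sym (edgeColour-succ 2<N (toℕ<n i) (toℕ<n j) i⇝j))
      (⇝-trans (toℕ<n i) (<⇒≤ 2<N) i⇝j (+ᶜ-⇝ (toℕ j) 1))

  rim-backward : ∀ {i j} → toℕ j ⇝[ 1 ] toℕ i → toℕ i ⇝[ 1 ] colour (suc i) (suc j)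
  rim-backward {i} j⇝i = subst (toℕ i ⇝[ 1 ]_) (sym (edgeColour-pred 2<N j⇝i)) (+ᶜ-⇝ (toℕ i) 1)

  colour-bounded : ∀ x y → colour x y < N
  colour-bounded zero    zero    = 0<N
  colour-bounded zero    (suc j) = toℕ<n j
  colour-bounded (suc i) zero    = toℕ<n i
  colour-bounded (suc i) (suc j) = edgeColour-< 2<N (toℕ<n i) (toℕ<n j)

  colour-symmetric : ∀ x y → Adj G x y → colour x y ≡ colour y x
  colour-symmetric zero    zero    _   = refl
  colour-symmetric zero    (suc _) _   = refl
  colour-symmetric (suc _) zero    _   = refl
  colour-symmetric (suc i) (suc j) i~j with cycle i j i~j
  ... | inj₁ i⇝j =
    trans (edgeColour-succ 2<N (toℕ<n i) (toℕ<n j) i⇝j) (sym (edgeColour-pred 2<N i⇝j))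
  ... | inj₂ j⇝i =
    trans (edgeColour-pred 2<N j⇝i) (sym (edgeColour-succ 2<N (toℕ<n j) (toℕ<n i) j⇝i))

  spoke≢rim : ∀ {i j} → Adj H i j → toℕ i ≢ colour (suc i) (suc j)
  spoke≢rim {i} {j} i~j e with cycle i j i~j
  ... | inj₁ i⇝j with () ← ⇝-steps-unique 0<N 2<N (subst (toℕ i ⇝[ 0 ]_) e ⇝-refl) (rim-forward i⇝j)
  ... | inj₂ j⇝i with () ← ⇝-steps-unique 0<N 1<N (subst (toℕ i ⇝[ 0 ]_) e ⇝-refl)
                                            (rim-backward j⇝i)

  rim-injective : ∀ {i j j′} → Adj H i j → Adj H i j′ →
                  colour (suc i) (suc j) ≡ colour (suc i) (suc j′) → j ≡ j′
  rim-injective {i} {j} {j′} i~j i~j′ same with cycle i j i~j | cycle i j′ i~j′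
  ... | inj₁ i⇝j | inj₁ i⇝j′ = toℕ-injective (⇝-target-unique (toℕ<n j) (toℕ<n j′) i⇝j i⇝j′)
  ... | inj₂ j⇝i | inj₂ j′⇝i = toℕ-injective (⇝-source-unique (toℕ<n j) (toℕ<n j′) j⇝i j′⇝i)
  ... | inj₁ i⇝j | inj₂ j′⇝i with () ← ⇝-steps-unique 2<N 1<N
    (rim-forward i⇝j) (subst (toℕ i ⇝[ 1 ]_) (sym same) (rim-backward j′⇝i))
  ... | inj₂ j⇝i | inj₁ i⇝j′ with () ← ⇝-steps-unique 2<N 1<N
    (rim-forward i⇝j′) (subst (toℕ i ⇝[ 1 ]_) same (rim-backward j⇝i))

  colour-proper : ∀ x y z → Adj G x y → Adj G x z → colour x y ≡ colour x z → y ≡ z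
  colour-proper zero    (suc j) (suc j′) _   _    e = cong suc (toℕ-injective e)
  colour-proper (suc i) zero    zero     _   _    _ = refl
  colour-proper (suc i) zero    (suc j)  _   i~j  e = ⊥-elim (spoke≢rim i~j e)
  colour-proper (suc i) (suc j) zero     i~j _    e = ⊥-elim (spoke≢rim i~j (sym e))
  colour-proper (suc i) (suc j) (suc j′) i~j i~j′ e = cong suc (rim-injective i~j i~j′ e)

  leaf-colour-steps : ∀ {i x} → Incident G colour (suc i) x → ∃[ d ] d ≤ 2 × toℕ i ⇝[ d ] x
  leaf-colour-steps {i} (zero , _ , e) = 0 , z≤n , subst (toℕ i ⇝[ 0 ]_) e ⇝-refl
  leaf-colour-steps {i} (suc j , i~j , e) with cycle i j i~j
  ... | inj₁ i⇝j = 2 , ≤-refl , subst (toℕ i ⇝[ 2 ]_) e (rim-forward i⇝j)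
  ... | inj₂ j⇝i = 1 , s≤s z≤n , subst (toℕ i ⇝[ 1 ]_) e (rim-backward j⇝i)

  centre-incident : ∀ x → x < N → Incident G colour zero x
  centre-incident x x<N = suc (fromℕ< x<N) , refl , toℕ-fromℕ< x<N

  centre≉leaf : ∀ i → (∀ x → Incident G colour zero x → Incident G colour (suc i) x) → ⊥
  centre≉leaf i into with leaf-colour-steps (into _ (centre-incident _ (+ᶜ-< (toℕ<n i) (<⇒≤ 3<N))))
  ... | d , d≤2 , i⇝x
    with refl ← ⇝-steps-unique (small<N (≤-trans d≤2 (s≤s (s≤s z≤n)))) 3<N i⇝x (+ᶜ-⇝ (toℕ i) 3)
    with s≤s (s≤s ()) ← d≤2

  colour-separating : ∀ u w → SameIncidence G colour u w → u ≡ w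
  colour-separating zero    zero    _    = refl
  colour-separating zero    (suc j) same = ⊥-elim (centre≉leaf j (Equivalence.to ∘ same))
  colour-separating (suc j) zero    same = ⊥-elim (centre≉leaf j (Equivalence.from ∘ same))
  colour-separating (suc u) (suc w) same
    with leaf-colour-steps (Equivalence.to (same _) (zero , refl , refl))
       | leaf-colour-steps (Equivalence.from (same _) (zero , refl , refl))
  ... | d₁ , d₁≤2 , w⇝u | d₂ , d₂≤2 , u⇝w =
    cong suc (toℕ-injective (⇝-round-trip (small<N (+-mono-≤ d₂≤2 d₁≤2)) u⇝w w⇝u))

  isSeparating : IsSeparatingℕ G N colour
  isSeparating = record
    { bounded    = colour-bounded
    ; symmetric  = colour-symmetric
    ; proper     = colour-proper
    ; onto       = λ x x<N → zero , centre-incident x x<N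
    ; separating = colour-separating
    }

apex-edgeLocating : ∀ H → Symmetric H → 5 ≤ V H → SubgraphOfCycle H →
                    HasEdgeLocating (K1 ⊕ H) (V H)
apex-edgeLocating H sH 5≤N cycle =
  edgeLocating-fromℕ (apex-symmetric H sH) (ApexColouring.isSeparating H 5≤N cycle)

≡true⇒T : ∀ {b} → b ≡ true → T b
≡true⇒T = Equivalence.from T-≡

path-edge : ∀ {n} (i j : Fin n) → T (pathAdj n i j) → suc (toℕ i) ≡ toℕ j ⊎ suc (toℕ j) ≡ toℕ i
path-edge i j e = map (sym ∘ ≡ᵇ⇒≡ _ _) (sym ∘ ≡ᵇ⇒≡ _ _) (Equivalence.to T-∨ e)

module _ (n : ℕ) where
  open CyclicSteps n

  closing⇒⇝ : ∀ {a b} → T (a ≡ᵇ 0) × T (suc b ≡ᵇ n) → b ⇝[ 1 ] a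
  closing⇒⇝ {a} {b} (a≡0 , b+1≡n) rewrite ≡ᵇ⇒≡ a 0 a≡0 =
    wrapping n (inj₂ refl) (trans (sym (≡ᵇ⇒≡ (suc b) n b+1≡n)) (+-comm 1 b))

  P-subgraphOfCycle : SubgraphOfCycle (P n)
  P-subgraphOfCycle i j e = map succ⇒⇝ succ⇒⇝ (path-edge i j (≡true⇒T e))

  C-subgraphOfCycle : SubgraphOfCycle (C n)
  C-subgraphOfCycle i j e with Equivalence.to T-∨ (≡true⇒T e)
  ... | inj₁ path = map succ⇒⇝ succ⇒⇝ (path-edge i j path)
  ... | inj₂ closing with Equivalence.to T-∨ closing
  ...   | inj₁ first-last = inj₂ (closing⇒⇝ (Equivalence.to T-∧ first-last))
  ...   | inj₂ last-first = inj₁ (closing⇒⇝ (Equivalence.to T-∧ last-first))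

partner : ℕ → ℕ
partner 0             = 1
partner 1             = 0
partner (suc (suc a)) = suc (suc (partner a))

partner-adjacent : ∀ a → suc a ≡ partner a ⊎ suc (partner a) ≡ a
partner-adjacent 0             = inj₁ refl
partner-adjacent 1             = inj₂ refl
partner-adjacent (suc (suc a)) = map (cong (2 +_)) (cong (2 +_)) (partner-adjacent a)

half-suc-suc : ∀ a → suc (suc a) / 2 ≡ suc (a / 2)
half-suc-suc a = m/n≡1+[m∸n]/n {suc (suc a)} {2} (s≤s (s≤s z≤n))

same-half⇒partner : ∀ a b → a / 2 ≡ b / 2 → a ≢ b → b ≡ partner a
same-half⇒partner 0 0 _ a≢b = ⊥-elim (a≢b refl)
same-half⇒partner 0 1 _ _ = refl
same-half⇒partner 0 (suc (suc b)) h _ = ⊥-elim (0≢1+n (trans h (half-suc-suc b)))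
same-half⇒partner 1 0 _ _ = refl
same-half⇒partner 1 1 _ a≢b = ⊥-elim (a≢b refl)
same-half⇒partner 1 (suc (suc b)) h _ = ⊥-elim (0≢1+n (trans h (half-suc-suc b)))
same-half⇒partner (suc (suc a)) 0 h _ = ⊥-elim (1+n≢0 (trans (sym (half-suc-suc a)) h))
same-half⇒partner (suc (suc a)) 1 h _ = ⊥-elim (1+n≢0 (trans (sym (half-suc-suc a)) h))
same-half⇒partner (suc (suc a)) (suc (suc b)) h a≢b = cong (2 +_) (same-half⇒partner a b
  (suc-injective (trans (sym (half-suc-suc a)) (trans h (half-suc-suc b)))) (a≢b ∘ cong (2 +_)))

nK2-partner : ∀ {n} {i j : Fin (V (nK2 n))} → Adj (nK2 n) i j → toℕ j ≡ partner (toℕ i)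
nK2-partner {i = i} {j} e with Equivalence.to T-∧ (≡true⇒T e)
... | same-half , distinct = same-half⇒partner (toℕ i) (toℕ j) (≡ᵇ⇒≡ _ _ same-half) i≢j
  where
  i≢j : toℕ i ≢ toℕ j
  i≢j i≡j = subst T (Equivalence.to T-not-≡ distinct) (≡⇒≡ᵇ _ _ i≡j)

nK2-subgraphOfCycle : ∀ n → SubgraphOfCycle (nK2 n)
nK2-subgraphOfCycle n i j e rewrite nK2-partner {n} {i} {j} e =
  map succ⇒⇝ succ⇒⇝ (partner-adjacent (toℕ i))
  where open CyclicSteps (n * 2)

-- Hub 0 sees 0, 1, …, 2n, hub 1 sees 0, 2, …, 2n + 1 and leaf j sees 0, j + 1, j + 2.
module BookColouring (k : ℕ) where
  private
    G : Graph
    G = Book (2 + k)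
    open Equivalence using (to; from)

  colour : Fin (V G) → Fin (V G) → ℕ
  colour zero          (suc (suc j)) = 1 + toℕ j
  colour (suc zero)    (suc (suc j)) = 2 + toℕ j
  colour (suc (suc j)) zero          = 1 + toℕ j
  colour (suc (suc j)) (suc zero)    = 2 + toℕ j
  colour _             _             = 0

  leaf≡ : ∀ {j j′ : Fin (V (nK2 (2 + k)))} → toℕ j ≡ toℕ j′ →
          _≡_ {A = Fin (V G)} (suc (suc j)) (suc (suc j′))
  leaf≡ = cong (λ j → suc (suc j)) ∘ toℕ-injective

  leaf-colours : ∀ {j x} → Incident G colour (suc (suc j)) x →
                 x ≡ 1 + toℕ j ⊎ x ≡ 2 + toℕ j ⊎ x ≡ 0
  leaf-colours (zero          , _ , e) = inj₁ (sym e)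
  leaf-colours (suc zero      , _ , e) = inj₂ (inj₁ (sym e))
  leaf-colours (suc (suc _)   , _ , e) = inj₂ (inj₂ (sym e))

  leaf-lacks : ∀ {j x} → x ≢ 1 + toℕ j → x ≢ 2 + toℕ j → x ≢ 0 → ¬ Incident G colour (suc (suc j)) x
  leaf-lacks ≢a ≢b ≢0 inc with leaf-colours inc
  ... | inj₁ e        = ≢a e
  ... | inj₂ (inj₁ e) = ≢b e
  ... | inj₂ (inj₂ e) = ≢0 e

  hub₀-sees : ∀ j → Incident G colour zero (1 + toℕ j)
  hub₀-sees j = suc (suc j) , refl , refl

  hub₁-sees : ∀ j → Incident G colour (suc zero) (2 + toℕ j)
  hub₁-sees j = suc (suc j) , refl , refl

  hub₀≉leaf : ∀ j → (∀ x → Incident G colour zero x → Incident G colour (suc (suc j)) x) → ⊥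
  hub₀≉leaf zero    into = leaf-lacks (λ ()) (λ ()) (λ ()) (into 3 (hub₀-sees (# 2)))
  hub₀≉leaf (suc j) into = leaf-lacks (λ ()) (λ ()) (λ ()) (into 1 (hub₀-sees (# 0)))

  hub₁≉leaf : ∀ j → (∀ x → Incident G colour (suc zero) x → Incident G colour (suc (suc j)) x) → ⊥
  hub₁≉leaf zero          into = leaf-lacks (λ ()) (λ ()) (λ ()) (into 3 (hub₁-sees (# 1)))
  hub₁≉leaf (suc zero)    into = leaf-lacks (λ ()) (λ ()) (λ ()) (into 4 (hub₁-sees (# 2)))
  hub₁≉leaf (suc (suc j)) into = leaf-lacks (λ ()) (λ ()) (λ ()) (into 2 (hub₁-sees (# 0)))

  hub₁-lacks-1 : ¬ Incident G colour (suc zero) 1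
  hub₁-lacks-1 (zero          , _ , ())
  hub₁-lacks-1 (suc zero      , () , _)
  hub₁-lacks-1 (suc (suc _)   , _ , ())

  leaves-coincide : ∀ {u w} → Incident G colour (suc (suc w)) (1 + toℕ u) →
                    Incident G colour (suc (suc u)) (1 + toℕ w) → u ≡ w
  leaves-coincide {u} {w} w∋u u∋w with leaf-colours w∋u | leaf-colours u∋w
  ... | inj₁ e | _ = toℕ-injective (suc-injective e)
  ... | _ | inj₁ e = sym (toℕ-injective (suc-injective e))
  ... | inj₂ (inj₁ e₁) | inj₂ (inj₁ e₂) =
    ⊥-elim (m≢1+n+m (toℕ u) (trans (suc-injective e₁) (cong suc (suc-injective e₂))))

  colour-bounded : ∀ x y → colour x y < V G
  colour-bounded zero          zero          = s≤s z≤n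
  colour-bounded zero          (suc zero)    = s≤s z≤n
  colour-bounded zero          (suc (suc j)) = s≤s (m<n⇒m<1+n (toℕ<n j))
  colour-bounded (suc zero)    zero          = s≤s z≤n
  colour-bounded (suc zero)    (suc zero)    = s≤s z≤n
  colour-bounded (suc zero)    (suc (suc j)) = s≤s (s≤s (toℕ<n j))
  colour-bounded (suc (suc j)) zero          = s≤s (m<n⇒m<1+n (toℕ<n j))
  colour-bounded (suc (suc j)) (suc zero)    = s≤s (s≤s (toℕ<n j))
  colour-bounded (suc (suc _)) (suc (suc _)) = s≤s z≤n

  colour-symmetric : ∀ x y → colour x y ≡ colour y x
  colour-symmetric zero          zero          = refl
  colour-symmetric zero          (suc zero)    = refl
  colour-symmetric zero          (suc (suc _)) = refl
  colour-symmetric (suc zero)    zero          = refl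
  colour-symmetric (suc zero)    (suc zero)    = refl
  colour-symmetric (suc zero)    (suc (suc _)) = refl
  colour-symmetric (suc (suc _)) zero          = refl
  colour-symmetric (suc (suc _)) (suc zero)    = refl
  colour-symmetric (suc (suc _)) (suc (suc _)) = refl

  colour-proper : ∀ x y z → Adj G x y → Adj G x z → colour x y ≡ colour x z → y ≡ z
  colour-proper zero          (suc zero)    (suc zero)    _ _ _ = refl
  colour-proper zero          (suc (suc j)) (suc (suc _)) _ _ e = leaf≡ (suc-injective e)
  colour-proper (suc zero)    zero          zero          _ _ _ = refl
  colour-proper (suc zero)    (suc (suc j)) (suc (suc _)) _ _ e =
    leaf≡ (suc-injective (suc-injective e))
  colour-proper (suc (suc j)) zero          zero          _ _ _ = refl
  colour-proper (suc (suc j)) (suc zero)    (suc zero)    _ _ _ = refl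
  colour-proper (suc (suc j)) zero          (suc zero)    _ _ e =
    ⊥-elim (1+n≢n (sym (suc-injective e)))
  colour-proper (suc (suc j)) (suc zero)    zero          _ _ e =
    ⊥-elim (1+n≢n (suc-injective e))
  colour-proper (suc (suc j)) (suc (suc j₁)) (suc (suc j₂)) j~j₁ j~j₂ _ =
    leaf≡ (trans (nK2-partner {2 + k} {j} {j₁} j~j₁) (sym (nK2-partner {2 + k} {j} {j₂} j~j₂)))
  colour-proper zero          (suc zero)    (suc (suc _)) _ _ ()
  colour-proper zero          (suc (suc _)) (suc zero)    _ _ ()
  colour-proper (suc zero)    zero          (suc (suc _)) _ _ ()
  colour-proper (suc zero)    (suc (suc _)) zero          _ _ ()
  colour-proper (suc (suc _)) zero          (suc (suc _)) _ _ ()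
  colour-proper (suc (suc _)) (suc zero)    (suc (suc _)) _ _ ()
  colour-proper (suc (suc _)) (suc (suc _)) zero          _ _ ()
  colour-proper (suc (suc _)) (suc (suc _)) (suc zero)    _ _ ()

  colour-onto : ∀ x → x < V G → ∃[ v ] Incident G colour v x
  colour-onto 0             _                = zero , suc zero , refl , refl
  colour-onto 1             _                = zero , suc (suc zero) , refl , refl
  colour-onto (suc (suc t)) (s≤s (s≤s t<2n)) =
    suc zero , suc (suc (fromℕ< t<2n)) , refl , cong (2 +_) (toℕ-fromℕ< t<2n)

  colour-separating : ∀ u w → SameIncidence G colour u w → u ≡ w
  colour-separating zero          zero          _    = refl
  colour-separating (suc zero)    (suc zero)    _    = refl
  colour-separating zero          (suc zero)    same =
    ⊥-elim (hub₁-lacks-1 (to (same 1) (suc (suc zero) , refl , refl)))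
  colour-separating (suc zero)    zero          same =
    ⊥-elim (hub₁-lacks-1 (from (same 1) (suc (suc zero) , refl , refl)))
  colour-separating zero          (suc (suc j)) same = ⊥-elim (hub₀≉leaf j (to ∘ same))
  colour-separating (suc (suc j)) zero          same = ⊥-elim (hub₀≉leaf j (from ∘ same))
  colour-separating (suc zero)    (suc (suc j)) same = ⊥-elim (hub₁≉leaf j (to ∘ same))
  colour-separating (suc (suc j)) (suc zero)    same = ⊥-elim (hub₁≉leaf j (from ∘ same))
  colour-separating (suc (suc u)) (suc (suc w)) same = cong (λ j → suc (suc j)) (leaves-coincide
    (to (same _) (zero , refl , refl)) (from (same _) (zero , refl , refl)))

  isSeparating : IsSeparatingℕ G (V G) colour
  isSeparating = record
    { bounded    = colour-bounded
    ; symmetric  = λ x y _ → colour-symmetric x y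
    ; proper     = colour-proper
    ; onto       = colour-onto
    ; separating = colour-separating
    }

byTable : ∀ {n k} → (ℕ → ℕ → Fin k) → Fin n → Fin n → Fin k
byTable t x y = t (toℕ x ⊓ toℕ y) (toℕ x ⊔ toℕ y)

fan₂-table : ℕ → ℕ → Fin 3
fan₂-table 0 1 = # 0
fan₂-table 0 2 = # 1
fan₂-table _ _ = # 2

fan₃-table : ℕ → ℕ → Fin 4
fan₃-table 0 1 = # 0
fan₃-table 0 2 = # 1
fan₃-table 0 3 = # 2
fan₃-table 1 2 = # 2
fan₃-table _ _ = # 3

windmill₂-table : ℕ → ℕ → Fin 5
windmill₂-table 0 1 = # 0
windmill₂-table 0 2 = # 1
windmill₂-table 0 3 = # 2
windmill₂-table 0 4 = # 3
windmill₂-table 1 2 = # 2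
windmill₂-table _ _ = # 4

wheel₄-table : ℕ → ℕ → Fin 4
wheel₄-table 0 1 = # 0
wheel₄-table 0 2 = # 1
wheel₄-table 0 3 = # 2
wheel₄-table 0 4 = # 3
wheel₄-table 1 2 = # 2
wheel₄-table 2 3 = # 3
wheel₄-table 1 4 = # 1
wheel₄-table _ _ = # 0

fan₂-upper : HasEdgeLocating (Fan 2) 3
fan₂-upper = edgeLocating-by-decision (apex-symmetric (P 2) (P-symmetric 2))
  (byTable fan₂-table) _

fan₃-upper : HasEdgeLocating (Fan 3) 4
fan₃-upper = edgeLocating-by-decision (apex-symmetric (P 3) (P-symmetric 3))
  (byTable fan₃-table) _

fan₄-upper : HasEdgeLocating (Fan 4) 4
fan₄-upper = edgeLocating-by-decision (apex-symmetric (P 4) (P-symmetric 4))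
  (byTable wheel₄-table) _

wheel₄-upper : HasEdgeLocating (Wheel 4) 4
wheel₄-upper = edgeLocating-by-decision (apex-symmetric (C 4) (C-symmetric 4))
  (byTable wheel₄-table) _

windmill₂-upper : HasEdgeLocating (Windmill 2) 5
windmill₂-upper = edgeLocating-by-decision (apex-symmetric (nK2 2) (nK2-symmetric 2))
  (byTable windmill₂-table) _

apex-lower : ∀ H m → HasEdgeLocating (K1 ⊕ H) m → V H ≤ m
apex-lower H m E = star⇒≤ E (dominating⇒star (K1 ⊕ H) zero (apex-dominating H))

fan₂-lower : ∀ m → HasEdgeLocating (Fan 2) m → 3 ≤ m
fan₂-lower m E = two-stars⇒< E (λ ())
  (dominating⇒star _ zero (apex-dominating (P 2)))
  (dominating⇒star _ (# 1) (toWitness {a? = dominating? (Fan 2) (# 1)} _))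

fan₃-lower : ∀ m → HasEdgeLocating (Fan 3) m → 4 ≤ m
fan₃-lower m E = two-stars⇒< E (λ ())
  (dominating⇒star _ zero (apex-dominating (P 3)))
  (dominating⇒star _ (# 2) (toWitness {a? = dominating? (Fan 3) (# 2)} _))

windmill₂-lower : ∀ m → HasEdgeLocating (Windmill 2) m → 5 ≤ m
windmill₂-lower m E = ≤∧≢⇒< (apex-lower (nK2 2) m E) 4≢m
  where
  4≢m : 4 ≢ m
  4≢m refl = Windmill₂.no-4-colouring E

windmill-lower : ∀ n m → HasEdgeLocating (Windmill n) m → 2 * n ≤ m
windmill-lower n m E = subst (_≤ m) (*-comm n 2) (apex-lower (nK2 n) m E)

book-size : ∀ n → V (Book n) ≡ 2 * n + 2
book-size n = trans (cong (2 +_) (*-comm n 2)) (+-comm 2 (2 * n))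

book-hub₀-dominating : ∀ n → Dominating (Book n) zero
book-hub₀-dominating n zero          0≢0 = ⊥-elim (0≢0 refl)
book-hub₀-dominating n (suc zero)    _   = refl
book-hub₀-dominating n (suc (suc _)) _   = refl

book-hub₁-dominating : ∀ n → Dominating (Book n) (suc zero)
book-hub₁-dominating n zero          _   = refl
book-hub₁-dominating n (suc zero)    1≢1 = ⊥-elim (1≢1 refl)
book-hub₁-dominating n (suc (suc _)) _   = refl

book-lower : ∀ n m → HasEdgeLocating (Book n) m → 2 * n + 2 ≤ m
book-lower n m E = subst (_≤ m) (book-size n) (two-stars⇒< E (λ ())
  (dominating⇒star _ zero (book-hub₀-dominating n))
  (dominating⇒star _ (suc zero) (book-hub₁-dominating n)))

wheel-upper : ∀ n → 4 ≤ n → HasEdgeLocating (Wheel n) n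
wheel-upper n 4≤n with m≤n⇒m<n∨m≡n 4≤n
... | inj₁ 5≤n = apex-edgeLocating (C n) (C-symmetric n) 5≤n (C-subgraphOfCycle n)
... | inj₂ refl = wheel₄-upper

fan-upper : ∀ n → 4 ≤ n → HasEdgeLocating (Fan n) n
fan-upper n 4≤n with m≤n⇒m<n∨m≡n 4≤n
... | inj₁ 5≤n = apex-edgeLocating (P n) (P-symmetric n) 5≤n (P-subgraphOfCycle n)
... | inj₂ refl = fan₄-upper

windmill-upper : ∀ n → 3 ≤ n → HasEdgeLocating (Windmill n) (2 * n)
windmill-upper n 3≤n = subst (HasEdgeLocating (Windmill n)) (*-comm n 2)
  (apex-edgeLocating (nK2 n) (nK2-symmetric n) (≤-trans (n≤1+n 5) (*-monoˡ-≤ 2 3≤n))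
    (nK2-subgraphOfCycle n))

book-upper : ∀ n → 2 ≤ n → HasEdgeLocating (Book n) (2 * n + 2)
book-upper 0 ()
book-upper 1 (s≤s ())
book-upper (suc (suc k)) _ = subst (HasEdgeLocating (Book (2 + k))) (book-size (2 + k))
  (edgeLocating-fromℕ (join-symmetric K2 (nK2 (2 + k)) K2-symmetric (nK2-symmetric (2 + k)))
    (BookColouring.isSeparating k))

theorem18 :
    (∀ n → 4 ≤ n → EdgeLocChromatic (Wheel n) n)
    × ((∀ n → 4 ≤ n → EdgeLocChromatic (Fan n) n)
       × EdgeLocChromatic (Fan 2) 3
       × EdgeLocChromatic (Fan 3) 4)
    × ((∀ n → 3 ≤ n → EdgeLocChromatic (Windmill n) (2 * n))
       × EdgeLocChromatic (Windmill 2) 5)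
    × ((∀ n → 3 ≤ n → EdgeLocChromatic (Book n) (2 * n + 2))
       × EdgeLocChromatic (Book 2) 6)
theorem18 =
    (λ n 4≤n → wheel-upper n 4≤n , apex-lower (C n))
  , ( (λ n 4≤n → fan-upper n 4≤n , apex-lower (P n))
    , (fan₂-upper , fan₂-lower)
    , (fan₃-upper , fan₃-lower))
  , ( (λ n 3≤n → windmill-upper n 3≤n , windmill-lower n)
    , (windmill₂-upper , windmill₂-lower))
  , ( (λ n 3≤n → book-upper n (≤-trans (n≤1+n 2) 3≤n) , book-lower n)
    , (book-upper 2 ≤-refl , book-lower 2))
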